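{- Let $G$ be an Eulerian digraph of maximum degree $4$ and let $n=|V(G)|$. Then $G$ strongly immerses into every $6n$-router $\mathcal R_{6n}$.
   Context: Digraphs are finite and may have loops and parallel edges; Eulerian means in-degree equals out-degree at every vertex. A circle is a directed cycle without repeated vertices. A $k$-router $\mathcal R_k$ is an Eulerian digraph with vertex set $\{v_{i,j}: 1\le i<j\le k\}$ (one vertex per unordered pair) together with a family of pairwise edge-disjoint circles $C_1,\dots,C_k$ whose union is the whole digraph and such that $V(C_i)\cap V(C_j)=\{v_{i,j}\}$ for all $i<j$. A strong immersion of $H$ into $G$ maps vertices of $H$ injectively to vertices of $G$ and each edge $(u,v)$ of $H$ to a directed trail (sequence of distinct edges, head of each equal to tail of the next) of $G$ from the image of $u$ to the image of $v$, such that trails of distinct edges are edge-disjoint and no image of a vertex of $H$ is an internal vertex of any trail. -}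

module Defs where

open import Data.Bool using (Bool; if_then_else_)
open import Data.Nat using (ℕ; zero; suc; _+_; _≤_)
open import Data.Fin using (Fin; _<_; _≟_)
open import Data.List using (List; []; _∷_; map)
open import Data.List.Membership.Propositional using (_∈_)
open import Data.List.Relation.Unary.Unique.Propositional using (Unique)
open import Data.Product using (Σ; ∃; ∃-syntax; _×_)
open import Data.Empty using (⊥)
open import Function using (_∘_)
open import Relation.Binary.PropositionalEquality using (_≡_; _≢_)
open import Relation.Nullary using (¬_)
open import Relation.Nullary.Decidable using (⌊_⌋)

record Digraph : Set where
  field
    nV nE : ℕ
    tail head : Fin nE → Fin nV
open Digraph public

V : Digraph → Set
V G = Fin (nV G)

E : Digraph → Set
E G = Fin (nE G)

count : ∀ {m} → (Fin m → Bool) → ℕ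
count {zero} p = 0
count {suc m} p = (if p Fin.zero then 1 else 0) + count (p ∘ Fin.suc)

indeg : (G : Digraph) → V G → ℕ
indeg G v = count (λ e → ⌊ head G e ≟ v ⌋)

outdeg : (G : Digraph) → V G → ℕ
outdeg G v = count (λ e → ⌊ tail G e ≟ v ⌋)

Eulerian : Digraph → Set
Eulerian G = ∀ v → indeg G v ≡ outdeg G v

-- degree of a vertex = in-degree + out-degree (a loop counts twice)
MaxDegree≤ : ℕ → Digraph → Set
MaxDegree≤ d G = ∀ v → indeg G v + outdeg G v ≤ d

data Walk (G : Digraph) : V G → List (E G) → V G → Set where
  []  : ∀ {u} → Walk G u [] u
  _∷_ : ∀ {e es w} → Walk G (head G e) es w → Walk G (tail G e) (e ∷ es) w

Trail : (G : Digraph) → V G → List (E G) → V G → Set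
Trail G u es w = Walk G u es w × Unique es × ¬ (es ≡ [])

internal : (G : Digraph) → List (E G) → List (V G)
internal G [] = []
internal G (e ∷ []) = []
internal G (e ∷ e′ ∷ es) = head G e ∷ internal G (e′ ∷ es)

-- vertices of a closed edge sequence
verts : (G : Digraph) → List (E G) → List (V G)
verts G es = map (tail G) es

Circle : (G : Digraph) → List (E G) → Set
Circle G es = Σ (V G) (λ u → Walk G u es u) × ¬ (es ≡ []) × Unique (verts G es)

-- R is a k-router: vertices are in bijection with pairs i<j of Fin k
-- (via vtx), and circles C₁ … C_k partition the edge set, with
-- V(C_i) ∩ V(C_j) = {v_ij} for i < j.
record Router (k : ℕ) (R : Digraph) : Set where
  field
    eulerian : Eulerian R
    vtx      : Fin k → Fin k → V R
    vtx-inj  : ∀ {i j i′ j′} → i < j → i′ < j′ → vtx i j ≡ vtx i′ j′ → (i ≡ i′) × (j ≡ j′)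
    vtx-surj : ∀ w → ∃[ i ] ∃[ j ] (i < j × vtx i j ≡ w)
    circ     : Fin k → List (E R)
    isCircle : ∀ i → Circle R (circ i)
    disjoint : ∀ i j → i ≢ j → ∀ e → e ∈ circ i → e ∈ circ j → ⊥
    cover    : ∀ e → ∃[ i ] (e ∈ circ i)
    meet→    : ∀ i j → i < j → ∀ w → w ∈ verts R (circ i) → w ∈ verts R (circ j) → w ≡ vtx i j
    meet←    : ∀ i j → i < j → vtx i j ∈ verts R (circ i) × vtx i j ∈ verts R (circ j)

record StrongImmersion (H G : Digraph) : Set where
  field
    φ          : V H → V G
    φ-inj      : ∀ {u v} → φ u ≡ φ v → u ≡ v
    path       : E H → List (E G)
    trail      : ∀ e → Trail G (φ (tail H e)) (path e) (φ (head H e))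
    disjoint   : ∀ e e′ → e ≢ e′ → ∀ f → f ∈ path e → f ∈ path e′ → ⊥
    noInternal : ∀ e v → φ v ∈ internal G (path e) → ⊥

-- Each vertex x of G is given six circles of the router: two bus circles, whose common
-- vertex is the image of x, and four link circles, each meeting one of the buses.  In- and
-- out-degrees are at most 2, so the out-edges at x can be labelled injectively by a bit b,
-- and likewise the in-edges.  An edge from x to y with out-label b and in-label b′ is routed
-- along bus b of x from x to one of its two link circles, along that link circle to its
-- junction with a link circle of y, along that one to bus b′ of y, and along it to y.  On a
-- bus the route leaving x ends at whichever link junction comes first after x, and the route
-- entering x starts at the other one, so the two arcs are edge-disjoint; every other circle
-- carries at most one route.  Link circles contain no image vertex and a bus contains only
-- its own one, so no route passes through the image of a vertex.
module Submission where

open import Defs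
open import Data.Bool using (Bool; true; false; not; if_then_else_)
open import Data.Bool.Properties using (T-≡; not-¬)
open import Data.Nat using (ℕ; zero; suc; _+_; _*_; _≤_; s≤s; z≤n; _≤?_)
open import Data.Nat.Properties using (+-suc; ≰⇒>; +-mono-<; <⇒≱; ≤-trans)
open import Data.Fin using (Fin; zero; suc; _≟_; combine)
import Data.Fin as Fin
import Data.Fin.Properties as Finₚ
open import Data.List using (List; []; _∷_; _++_; length; concatMap)
open import Data.List.Properties using (map-++; ++-assoc; ++-conicalˡ; ++-identityʳ)
open import Data.List.Membership.Propositional using (_∈_)
open import Data.List.Membership.Propositional.Properties using (∈-++⁻; ∈-concatMap⁻)
open import Data.List.Relation.Unary.Any using (here; there; satisfied)
open import Data.List.Relation.Unary.All as All using (All; []; _∷_)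
import Data.List.Relation.Unary.All.Properties as All
import Data.List.Relation.Unary.AllPairs as AllPairs
import Data.List.Relation.Unary.AllPairs.Properties as AllPairs
open import Data.List.Relation.Unary.Unique.Propositional using (Unique; []; _∷_)
import Data.List.Relation.Unary.Unique.Propositional.Properties as Unique
open import Data.List.Relation.Binary.Disjoint.Propositional using (Disjoint)
open import Data.List.Relation.Binary.Subset.Propositional using (_⊆_)
open import Data.List.Relation.Binary.Subset.Propositional.Properties using (xs⊆xs++ys; xs⊆ys++xs; ⊆-reflexive-↭)
import Data.List.Relation.Binary.Subset.Propositional.Properties as Subset
open import Data.List.Relation.Binary.Permutation.Propositional using (_↭_; ↭-sym; ↭-trans; ↭-reflexive; ↭⇒↭ₛ)
import Data.List.Relation.Binary.Permutation.Propositional.Properties as Perm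
import Data.List.Relation.Binary.Permutation.Setoid.Properties as PermSetoid
open import Data.Product using (∃; ∃₂; _×_; _,_; proj₁; proj₂; swap)
open import Data.Sum using (_⊎_; inj₁; inj₂; [_,_])
open import Data.Empty using (⊥; ⊥-elim)
open import Function using (_∘_)
open import Function.Bundles using (Equivalence)
open import Relation.Binary.Definitions using (tri<; tri≈; tri>)
open import Relation.Binary.PropositionalEquality
  using (_≡_; _≢_; refl; sym; ≢-sym; trans; cong; cong₂; subst; setoid; module ≡-Reasoning)
open import Relation.Nullary using (Dec; yes; no; contradiction)
open import Relation.Nullary.Decidable using (⌊_⌋; dec-true; isYes≗does; toWitness; _×-dec_)

module _ {A : Set} where

  Unique-++⁻ˡ : ∀ xs {ys : List A} → Unique (xs ++ ys) → Unique xs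
  Unique-++⁻ˡ []       _          = []
  Unique-++⁻ˡ (x ∷ xs) (x∉ ∷ xs!) = All.++⁻ˡ xs x∉ ∷ Unique-++⁻ˡ xs xs!

  Unique-++⇒Disjoint : ∀ xs {ys : List A} → Unique (xs ++ ys) → Disjoint xs ys
  Unique-++⇒Disjoint (x ∷ xs) (x∉ ∷ _)   (here refl , y∈) = All.lookup (All.++⁻ʳ xs x∉) y∈ refl
  Unique-++⇒Disjoint (x ∷ xs) (_ ∷ xs!) (there p , y∈)   = Unique-++⇒Disjoint xs xs! (p , y∈)

  Unique-resp-↭ : ∀ {xs ys : List A} → xs ↭ ys → Unique xs → Unique ys
  Unique-resp-↭ σ = PermSetoid.Unique-resp-↭ (setoid A) (↭⇒↭ₛ σ)

module WalkProperties (D : Digraph) where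

  _++ʷ_ : ∀ {u v w as bs} → Walk D u as v → Walk D v bs w → Walk D u (as ++ bs) w
  []      ++ʷ q = q
  (_∷_ p) ++ʷ q = _∷_ (p ++ʷ q)

  split : ∀ {u w v es} → Walk D u es w → v ∈ verts D es →
          ∃₂ λ as bs → es ≡ as ++ bs × Walk D u as v × Walk D v bs w × v ∈ verts D bs
  split (_∷_ p) (here refl) = [] , _ , refl , [] , _∷_ p , here refl
  split (_∷_ p) (there v∈) with split p v∈
  ... | as , bs , refl , p₁ , p₂ , v∈bs = _ ∷ as , bs , refl , _∷_ p₁ , p₂ , v∈bs

  start∈verts : ∀ {u w es} → Walk D u es w → u ≢ w → u ∈ verts D es
  start∈verts []      u≢w = ⊥-elim (u≢w refl)
  start∈verts (_∷_ _) _   = here refl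

  verts-++ : ∀ as bs → verts D (as ++ bs) ≡ verts D as ++ verts D bs
  verts-++ = map-++ (tail D)

  verts-++⁻ : ∀ as {bs v} → v ∈ verts D (as ++ bs) → v ∈ verts D as ⊎ v ∈ verts D bs
  verts-++⁻ as {bs} v∈ rewrite verts-++ as bs = ∈-++⁻ (verts D as) v∈

  verts-mono : ∀ {as bs} → as ⊆ bs → verts D as ⊆ verts D bs
  verts-mono = Subset.map⁺ (tail D)

  start≡tail : ∀ {u w e es} → Walk D u (e ∷ es) w → u ≡ tail D e
  start≡tail (_∷_ _) = refl

  internal-∷ : ∀ {u w e es} → Walk D u (e ∷ es) w → internal D (e ∷ es) ≡ verts D es
  internal-∷ {es = []}    _       = refl
  internal-∷ {es = _ ∷ _} (_∷_ p) = cong₂ _∷_ (start≡tail p) (internal-∷ p)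

  internal-++⁺ : ∀ {P : V D → Set} {u w as bs} → Walk D u as w →
                 All P (internal D as) → P w → All P (internal D bs) → All P (internal D (as ++ bs))
  internal-++⁺ {as = []}        []       _          _  Pbs = Pbs
  internal-++⁺ {as = _ ∷ []} {bs = []}    (_∷_ _)  _  _  _   = []
  internal-++⁺ {as = _ ∷ []} {bs = _ ∷ _} (_∷_ []) _  Pw Pbs = Pw ∷ Pbs
  internal-++⁺ {as = _ ∷ _ ∷ _} (_∷_ p)   (Pv ∷ Pas) Pw Pbs = Pv ∷ internal-++⁺ p Pas Pw Pbs

  nonempty : ∀ {u w es} → Walk D u es w → u ≢ w → es ≢ []
  nonempty []      u≢w _ = u≢w refl
  nonempty (_∷_ _) _   ()

  internal-prefix : ∀ {u w v as bs} → Walk D u as w → Unique (verts D (as ++ bs)) → w ∈ verts D bs →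
                    v ∈ internal D as → v ∈ verts D as × v ≢ u × v ≢ w
  internal-prefix {as = a ∷ as} {bs} p@(_∷_ _) (a∉ ∷ rest) w∈bs v∈ with subst (_ ∈_) (internal-∷ p) v∈
  ... | v∈as = there v∈as
             , (λ { refl → All.lookup a∉ (verts-mono (xs⊆xs++ys as bs) v∈as) refl })
             , (λ { refl → Unique-++⇒Disjoint (verts D as) (subst Unique (verts-++ as bs) rest) (v∈as , w∈bs) })

module CircleArcs {D : Digraph} {cs : List (E D)} (circle : Circle D cs) where
  open WalkProperties D

  record Arc (u w : V D) : Set where
    field
      edges : List (E D)
      trail : Trail D u edges w
      ⊆cs   : edges ⊆ cs
      inner : ∀ {v} → v ∈ internal D edges → v ∈ verts D cs × v ≢ u × v ≢ w

    walk : Walk D u edges w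
    walk = proj₁ trail

    unique : Unique edges
    unique = proj₁ (proj₂ trail)

  private
    base : V D
    base = proj₁ (proj₁ circle)

    closed : Walk D base cs base
    closed = proj₂ (proj₁ circle)

    verts! : Unique (verts D cs)
    verts! = proj₂ (proj₂ circle)

  verts-unique : ∀ {es} → es ↭ cs → Unique (verts D es)
  verts-unique σ = Unique-resp-↭ (↭-sym (Perm.map⁺ (tail D) σ)) verts!

  edges-unique : ∀ {es} → es ↭ cs → Unique es
  edges-unique σ = Unique.map⁻ (verts-unique σ)

  verts-resp-↭ : ∀ {es} → es ↭ cs → verts D cs ⊆ verts D es
  verts-resp-↭ σ = ⊆-reflexive-↭ (Perm.map⁺ (tail D) (↭-sym σ))

  rotate : ∀ {u} → u ∈ verts D cs → ∃ λ es → Walk D u es u × es ↭ cs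
  rotate u∈ with split closed u∈
  ... | as , bs , cs≡ , p , q , _ =
    bs ++ as , q ++ʷ p , ↭-trans (Perm.++-comm bs as) (↭-reflexive (sym cs≡))

  prefixArc : ∀ {as bs u w} → as ++ bs ↭ cs → Walk D u as w → w ∈ verts D bs → u ≢ w → Arc u w
  prefixArc {as} {bs} σ p w∈bs u≢w = record
    { edges = as
    ; trail = p , Unique-++⁻ˡ as (edges-unique σ) , nonempty p u≢w
    ; ⊆cs   = as⊆cs
    ; inner = λ v∈ → let v∈as , v≢u , v≢w = internal-prefix p (verts-unique σ) w∈bs v∈
                     in verts-mono as⊆cs v∈as , v≢u , v≢w }
    where
      as⊆cs : as ⊆ cs
      as⊆cs f∈ = ⊆-reflexive-↭ σ (xs⊆xs++ys as bs f∈)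

  arc : ∀ {u w} → u ∈ verts D cs → w ∈ verts D cs → u ≢ w → Arc u w
  arc u∈ w∈ u≢w with rotate u∈
  ... | es , p , σ with split p (verts-resp-↭ σ w∈)
  ... | as , bs , refl , p₁ , _ , w∈bs = prefixArc σ p₁ w∈bs u≢w

  record TwoArcs (u : V D) (g : Bool → V D) : Set where
    field
      first    : Bool
      out      : Arc u (g first)
      inn      : Arc (g (not first)) u
      disjoint : Disjoint (Arc.edges out) (Arc.edges inn)

  twoArcs : ∀ {u} (g : Bool → V D) → u ∈ verts D cs → (∀ c → g c ∈ verts D cs) → (∀ c → u ≢ g c) →
            TwoArcs u g
  twoArcs g u∈ g∈ u≢g with rotate u∈
  ... | es , p , σ with split p (verts-resp-↭ σ (g∈ true))
  ... | ps , qs , refl , p₁ , q , t∈qs with verts-++⁻ ps (verts-resp-↭ σ (g∈ false))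
  ... | inj₂ f∈qs with split q f∈qs
  ...   | qs₁ , qs₂ , refl , _ , q₂ , f∈qs₂ = record
    { first    = true
    ; out      = prefixArc σ p₁ t∈qs (u≢g true)
    ; inn      = prefixArc σ′ q₂ (verts-mono (xs⊆xs++ys ps qs₁) (start∈verts p₁ (u≢g true))) (≢-sym (u≢g false))
    ; disjoint = λ (f∈ps , f∈qs₂) →
                   Unique-++⇒Disjoint ps (edges-unique σ) (f∈ps , xs⊆ys++xs qs₂ qs₁ f∈qs₂) }
    where
      σ′ : qs₂ ++ ps ++ qs₁ ↭ cs
      σ′ = ↭-trans (Perm.++-comm qs₂ (ps ++ qs₁)) (↭-trans (↭-reflexive (++-assoc ps qs₁ qs₂)) σ)
  twoArcs g u∈ g∈ u≢g | es , p , σ | ps , qs , refl , p₁ , q , t∈qs | inj₁ f∈ps with split p₁ f∈ps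
  ...   | ps₁ , ps₂ , refl , p₁₁ , _ , f∈ps₂ = record
    { first    = false
    ; out      = prefixArc σ′ p₁₁ (verts-mono (xs⊆xs++ys ps₂ qs) f∈ps₂) (u≢g false)
    ; inn      = prefixArc (↭-trans (Perm.++-comm qs (ps₁ ++ ps₂)) σ) q
                   (start∈verts p₁ (u≢g true)) (≢-sym (u≢g true))
    ; disjoint = λ (f∈ps₁ , f∈qs) →
                   Unique-++⇒Disjoint (ps₁ ++ ps₂) (edges-unique σ) (xs⊆xs++ys ps₁ ps₂ f∈ps₁ , f∈qs) }
    where
      σ′ : ps₁ ++ ps₂ ++ qs ↭ cs
      σ′ = ↭-trans (↭-reflexive (sym (++-assoc ps₁ ps₂ qs))) σ

m+m≤n+n⇒m≤n : ∀ {m n} → m + m ≤ n + n → m ≤ n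
m+m≤n+n⇒m≤n {m} {n} m+m≤n+n with m ≤? n
... | yes m≤n = m≤n
... | no  m≰n = contradiction m+m≤n+n (<⇒≱ (+-mono-< (≰⇒> m≰n) (≰⇒> m≰n)))

remove : ∀ {m} → (Fin m → Bool) → Fin m → Fin m → Bool
remove p i j = if ⌊ j ≟ i ⌋ then false else p j

remove-≢ : ∀ {m} (p : Fin m → Bool) {i j} → j ≢ i → remove p i j ≡ p j
remove-≢ p {i} {j} j≢i with j ≟ i
... | yes j≡i = contradiction j≡i j≢i
... | no  _   = refl

count-cong : ∀ {m} {p q : Fin m → Bool} → (∀ i → p i ≡ q i) → count p ≡ count q
count-cong {zero}  _   = refl
count-cong {suc m} p≗q rewrite p≗q zero = cong (_ +_) (count-cong (λ i → p≗q (suc i)))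

remove-suc : ∀ {m} (p : Fin (suc m) → Bool) i j → remove (λ k → p (suc k)) i j ≡ remove p (suc i) (suc j)
remove-suc p i j with j ≟ i
... | yes refl = refl
... | no  _    = refl

count-remove : ∀ {m} (p : Fin m → Bool) i → p i ≡ true → count p ≡ suc (count (remove p i))
count-remove p zero    pi≡true rewrite pi≡true = refl
count-remove p (suc i) pi≡true = begin
  p₀ + count (λ j → p (suc j))                  ≡⟨ cong (p₀ +_) (count-remove (λ j → p (suc j)) i pi≡true) ⟩
  p₀ + suc (count (remove (λ j → p (suc j)) i)) ≡⟨ +-suc p₀ _ ⟩
  suc (p₀ + count (remove (λ j → p (suc j)) i)) ≡⟨ cong (λ c → suc (p₀ + c)) (count-cong (remove-suc p i)) ⟩
  suc (count (remove p (suc i)))                ∎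
  where
    open ≡-Reasoning
    p₀ : ℕ
    p₀ = if p zero then 1 else 0

length≤count : ∀ {m} (p : Fin m → Bool) {is} → Unique is → All (λ i → p i ≡ true) is → length is ≤ count p
length≤count p []           []           = z≤n
length≤count p (i∉ ∷ is!) (pi ∷ pis) rewrite count-remove p _ pi =
  s≤s (length≤count (remove p _) is! (All.zipWith (λ (i≢j , pj) → trans (remove-≢ p (≢-sym i≢j)) pj) (i∉ , pis)))

⌊⌋≡true : ∀ {P : Set} (P? : Dec P) → P → ⌊ P? ⌋ ≡ true
⌊⌋≡true P? p = trans (isYes≗does P?) (dec-true P? p)

module FibreLabelling {m n : ℕ} (t : Fin m → Fin n) (fibre≤2 : ∀ v → count (λ e → ⌊ t e ≟ v ⌋) ≤ 2) where

  hasEarlierSibling? : ∀ e → Dec (∃ λ e′ → e′ Fin.< e × t e′ ≡ t e)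
  hasEarlierSibling? e = Finₚ.any? (λ e′ → e′ Finₚ.<? e ×-dec t e′ ≟ t e)

  label : Fin m → Bool
  label e = ⌊ hasEarlierSibling? e ⌋

  no-three-siblings : ∀ {e₁ e₂ e₃} → e₁ Fin.< e₂ → e₂ Fin.< e₃ → t e₁ ≡ t e₂ → t e₂ ≡ t e₃ → ⊥
  no-three-siblings {e₁} {e₂} {e₃} e₁<e₂ e₂<e₃ t₁≡t₂ t₂≡t₃ with
    ≤-trans (length≤count (λ e → ⌊ t e ≟ t e₂ ⌋) distinct siblings) (fibre≤2 (t e₂))
    where
      distinct : Unique (e₁ ∷ e₂ ∷ e₃ ∷ [])
      distinct = (Finₚ.<⇒≢ e₁<e₂ ∷ Finₚ.<⇒≢ (Finₚ.<-trans e₁<e₂ e₂<e₃) ∷ [])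
               ∷ (Finₚ.<⇒≢ e₂<e₃ ∷ []) ∷ [] ∷ []
      siblings : All (λ e → ⌊ t e ≟ t e₂ ⌋ ≡ true) (e₁ ∷ e₂ ∷ e₃ ∷ [])
      siblings = ⌊⌋≡true (t e₁ ≟ t e₂) t₁≡t₂
               ∷ ⌊⌋≡true (t e₂ ≟ t e₂) refl
               ∷ ⌊⌋≡true (t e₃ ≟ t e₂) (sym t₂≡t₃) ∷ []
  ... | s≤s (s≤s ())

  label-<-distinct : ∀ {e e′} → e Fin.< e′ → t e ≡ t e′ → label e ≢ label e′
  label-<-distinct {e} {e′} e<e′ te≡te′ ℓ≡ℓ′
    with toWitness {a? = hasEarlierSibling? e}
           (Equivalence.from T-≡ (trans ℓ≡ℓ′ (⌊⌋≡true (hasEarlierSibling? e′) (e , e<e′ , te≡te′))))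
  ... | e₀ , e₀<e , te₀≡te = no-three-siblings e₀<e e<e′ te₀≡te te≡te′

  label-injective : ∀ {e e′} → t e ≡ t e′ → label e ≡ label e′ → e ≡ e′
  label-injective {e} {e′} te≡te′ ℓ≡ℓ′ with Finₚ.<-cmp e e′
  ... | tri< e<e′ _ _ = contradiction ℓ≡ℓ′ (label-<-distinct e<e′ te≡te′)
  ... | tri≈ _ e≡e′ _ = e≡e′
  ... | tri> _ _ e′<e = contradiction (sym ℓ≡ℓ′) (label-<-distinct e′<e (sym te≡te′))

module RouterProperties {k : ℕ} {R : Digraph} (router : Router k R) where
  open Router router

  junction : Fin k → Fin k → V R
  junction i j with Finₚ.<-cmp i j
  ... | tri< _ _ _ = vtx i j
  ... | tri≈ _ _ _ = vtx i j
  ... | tri> _ _ _ = vtx j i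

  junction∈circ : ∀ {i j} → i ≢ j → junction i j ∈ verts R (circ i) × junction i j ∈ verts R (circ j)
  junction∈circ {i} {j} i≢j with Finₚ.<-cmp i j
  ... | tri< i<j _ _ = meet← i j i<j
  ... | tri≈ _ i≡j _ = contradiction i≡j i≢j
  ... | tri> _ _ j<i = swap (meet← j i j<i)

  meet : ∀ {i j w} → i ≢ j → w ∈ verts R (circ i) → w ∈ verts R (circ j) → w ≡ junction i j
  meet {i} {j} {w} i≢j w∈i w∈j with Finₚ.<-cmp i j
  ... | tri< i<j _ _ = meet→ i j i<j w w∈i w∈j
  ... | tri≈ _ i≡j _ = contradiction i≡j i≢j
  ... | tri> _ _ j<i = meet→ j i j<i w w∈j w∈i

  junction-injective : ∀ {i j i′ j′} → i ≢ j → i′ ≢ j′ → junction i j ≡ junction i′ j′ →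
                       (i ≡ i′ × j ≡ j′) ⊎ (i ≡ j′ × j ≡ i′)
  junction-injective {i} {j} {i′} {j′} i≢j i′≢j′ eq with Finₚ.<-cmp i j | Finₚ.<-cmp i′ j′
  ... | tri≈ _ i≡j _ | _              = contradiction i≡j i≢j
  ... | _            | tri≈ _ i′≡j′ _ = contradiction i′≡j′ i′≢j′
  ... | tri< i<j _ _ | tri< i′<j′ _ _ = inj₁ (vtx-inj i<j i′<j′ eq)
  ... | tri< i<j _ _ | tri> _ _ j′<i′ = inj₂ (vtx-inj i<j j′<i′ eq)
  ... | tri> _ _ j<i | tri< i′<j′ _ _ = inj₂ (swap (vtx-inj j<i i′<j′ eq))
  ... | tri> _ _ j<i | tri> _ _ j′<i′ = inj₁ (swap (vtx-inj j<i j′<i′ eq))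

  junction-on-circ : ∀ {i j l} → i ≢ j → junction i j ∈ verts R (circ l) → l ≡ i ⊎ l ≡ j
  junction-on-circ {i} {j} {l} i≢j on-l with l ≟ i
  ... | yes l≡i = inj₁ l≡i
  ... | no  l≢i with junction-injective i≢j l≢i (meet l≢i on-l (proj₁ (junction∈circ i≢j)))
  ...   | inj₁ (i≡l , _) = contradiction (sym i≡l) l≢i
  ...   | inj₂ (_ , j≡l) = inj₂ (sym j≡l)

  junction-≢ : ∀ {i j m w} → i ≢ j → m ≢ i → m ≢ j → w ∈ verts R (circ m) → junction i j ≢ w
  junction-≢ i≢j m≢i m≢j w∈m refl = [ m≢i , m≢j ] (junction-on-circ i≢j w∈m)

  circ-unique : ∀ {i j f} → f ∈ circ i → f ∈ circ j → i ≡ j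
  circ-unique {i} {j} {f} f∈i f∈j with i ≟ j
  ... | yes i≡j = i≡j
  ... | no  i≢j = ⊥-elim (disjoint i j i≢j f f∈i f∈j)

data Role : Set where
  bus  : Bool → Role
  link : Bool → Bool → Role

role→fin : Role → Fin 6
role→fin (bus false)        = zero
role→fin (bus true)         = suc zero
role→fin (link false false) = suc (suc zero)
role→fin (link false true)  = suc (suc (suc zero))
role→fin (link true false)  = suc (suc (suc (suc zero)))
role→fin (link true true)   = suc (suc (suc (suc (suc zero))))

fin→role : Fin 6 → Role
fin→role zero                                = bus false
fin→role (suc zero)                          = bus true
fin→role (suc (suc zero))                    = link false false
fin→role (suc (suc (suc zero)))              = link false true
fin→role (suc (suc (suc (suc zero))))        = link true false
fin→role (suc (suc (suc (suc (suc zero)))))  = link true true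

fin→role∘role→fin : ∀ r → fin→role (role→fin r) ≡ r
fin→role∘role→fin (bus false)        = refl
fin→role∘role→fin (bus true)         = refl
fin→role∘role→fin (link false false) = refl
fin→role∘role→fin (link false true)  = refl
fin→role∘role→fin (link true false)  = refl
fin→role∘role→fin (link true true)   = refl

role→fin-injective : ∀ {r r′} → role→fin r ≡ role→fin r′ → r ≡ r′
role→fin-injective {r} {r′} eq =
  trans (sym (fin→role∘role→fin r)) (trans (cong fin→role eq) (fin→role∘role→fin r′))

bus-injective : ∀ {b b′} → bus b ≡ bus b′ → b ≡ b′
bus-injective refl = refl

link-injective : ∀ {b b′ c c′} → link b c ≡ link b′ c′ → b ≡ b′ × c ≡ c′
link-injective refl = refl , refl

data Leg : Set where
  leave tailLink headLink arrive : Leg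

legs : List Leg
legs = leave ∷ tailLink ∷ headLink ∷ arrive ∷ []

legs-unique : Unique legs
legs-unique = ((λ ()) ∷ (λ ()) ∷ (λ ()) ∷ []) ∷ ((λ ()) ∷ (λ ()) ∷ []) ∷ ((λ ()) ∷ []) ∷ [] ∷ []

module Construction (G : Digraph) (eulerian : Eulerian G) (deg≤4 : MaxDegree≤ 4 G)
                    (R : Digraph) (router : Router (6 * nV G) R) where
  open Router router using (circ; isCircle)
  open RouterProperties router
  open WalkProperties R
  open CircleArcs using (Arc; arc; TwoArcs; twoArcs)

  circle : Role → V G → Fin (6 * nV G)
  circle r x = combine (role→fin r) x

  circle-injective : ∀ r x r′ x′ → circle r x ≡ circle r′ x′ → r ≡ r′ × x ≡ x′
  circle-injective r x r′ x′ eq =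
    let fin≡ , x≡ = Finₚ.combine-injective (role→fin r) x (role→fin r′) x′ eq
    in role→fin-injective fin≡ , x≡

  link≢bus : ∀ b c x b′ y → circle (link b c) x ≢ circle (bus b′) y
  link≢bus b c x b′ y eq with () ← proj₁ (circle-injective (link b c) x (bus b′) y eq)

  bus-false≢true : ∀ x → circle (bus false) x ≢ circle (bus true) x
  bus-false≢true x eq with () ← proj₁ (circle-injective (bus false) x (bus true) x eq)

  hub : V G → V R
  hub x = junction (circle (bus false) x) (circle (bus true) x)

  hub∈bus : ∀ x b → hub x ∈ verts R (circ (circle (bus b) x))
  hub∈bus x false = proj₁ (junction∈circ (bus-false≢true x))
  hub∈bus x true  = proj₂ (junction∈circ (bus-false≢true x))

  hub-on-circ : ∀ r x {v} → hub v ∈ verts R (circ (circle r x)) → ∃ λ b → r ≡ bus b × x ≡ v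
  hub-on-circ r x {v} on with junction-on-circ (bus-false≢true v) on
  ... | inj₁ eq = false , circle-injective r x (bus false) v eq
  ... | inj₂ eq = true  , circle-injective r x (bus true) v eq

  hub-injective : ∀ {u v} → hub u ≡ hub v → u ≡ v
  hub-injective {u} eq = proj₂ (proj₂ (hub-on-circ (bus false) u (subst (_∈ _) eq (hub∈bus u false))))

  NotHub : V R → Set
  NotHub w = ∀ v → w ≢ hub v

  link-circle-NotHub : ∀ b c x {w} → w ∈ verts R (circ (circle (link b c) x)) → NotHub w
  link-circle-NotHub b c x on v refl with hub-on-circ (link b c) x {v} on
  ... | _ , () , _

  bus-circle-NotHub : ∀ b x {w} → w ∈ verts R (circ (circle (bus b) x)) → w ≢ hub x → NotHub w
  bus-circle-NotHub b x on w≢hub v refl with hub-on-circ (bus b) x {v} on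
  ... | _ , _ , refl = w≢hub refl

  port : V G → Bool → Bool → V R
  port x b c = junction (circle (link b c) x) (circle (bus b) x)

  port∈link : ∀ x b c → port x b c ∈ verts R (circ (circle (link b c) x))
  port∈link x b c = proj₁ (junction∈circ (link≢bus b c x b x))

  port∈bus : ∀ x b c → port x b c ∈ verts R (circ (circle (bus b) x))
  port∈bus x b c = proj₂ (junction∈circ (link≢bus b c x b x))

  opaque
    busArcs : ∀ x b → TwoArcs (isCircle (circle (bus b) x)) (hub x) (port x b)
    busArcs x b = twoArcs (isCircle _) (port x b) (hub∈bus x b) (port∈bus x b)
      (λ c → ≢-sym (link-circle-NotHub b c x (port∈link x b c) x))

  outdeg≤2 : ∀ v → outdeg G v ≤ 2
  outdeg≤2 v = m+m≤n+n⇒m≤n (subst (λ d → d + outdeg G v ≤ 4) (eulerian v) (deg≤4 v))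

  indeg≤2 : ∀ v → indeg G v ≤ 2
  indeg≤2 v = m+m≤n+n⇒m≤n (subst (λ d → indeg G v + d ≤ 4) (sym (eulerian v)) (deg≤4 v))

  open FibreLabelling (tail G) outdeg≤2 using () renaming (label to outLabel; label-injective to outLabel-injective)
  open FibreLabelling (head G) indeg≤2  using () renaming (label to inLabel;  label-injective to inLabel-injective)

  first : V G → Bool → Bool
  first x b = TwoArcs.first (busArcs x b)

  first≢not-first : ∀ {x y b b′} → x ≡ y → b ≡ b′ → first x b ≢ not (first y b′)
  first≢not-first x≡y b≡b′ = not-¬ (cong₂ first x≡y b≡b′)

  entry≢exit : ∀ y b′ x b → circle (link b′ (not (first y b′))) y ≢ circle (link b (first x b)) x
  entry≢exit y b′ x b eq =
    let r≡ , y≡x = circle-injective (link b′ (not (first y b′))) y (link b (first x b)) x eq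
        b′≡b , c≡ = link-injective r≡
    in first≢not-first (sym y≡x) (sym b′≡b) (sym c≡)

  module _ (e : E G) where
    private
      x y : V G
      x = tail G e
      y = head G e
      b b′ c c′ : Bool
      b  = outLabel e
      b′ = inLabel e
      c  = first x b
      c′ = not (first y b′)
      in≢out : circle (link b′ c′) y ≢ circle (link b c) x
      in≢out = entry≢exit y b′ x b
      mid : V R
      mid = junction (circle (link b′ c′) y) (circle (link b c) x)

    legRole : Leg → Role
    legRole leave    = bus b
    legRole tailLink = link b c
    legRole headLink = link b′ c′
    legRole arrive   = bus b′

    legVertex : Leg → V G
    legVertex leave    = x
    legVertex tailLink = x
    legVertex headLink = y
    legVertex arrive   = y

    legCircle : Leg → Fin (6 * nV G)
    legCircle l = circle (legRole l) (legVertex l)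

    legStart legEnd : Leg → V R
    legStart leave    = hub x
    legStart tailLink = port x b c
    legStart headLink = mid
    legStart arrive   = port y b′ c′
    legEnd leave    = port x b c
    legEnd tailLink = mid
    legEnd headLink = port y b′ c′
    legEnd arrive   = hub y

    legArc : ∀ l → Arc (isCircle (legCircle l)) (legStart l) (legEnd l)
    legArc leave    = TwoArcs.out (busArcs x b)
    legArc tailLink = arc (isCircle _) (port∈link x b c) (proj₂ (junction∈circ in≢out))
      (junction-≢ (link≢bus b c x b x) in≢out (link≢bus b′ c′ y b x) (proj₁ (junction∈circ in≢out)))
    legArc headLink = arc (isCircle _) (proj₁ (junction∈circ in≢out)) (port∈link y b′ c′)
      (junction-≢ in≢out (≢-sym (link≢bus b′ c′ y b′ y)) (≢-sym (link≢bus b c x b′ y)) (port∈bus y b′ c′))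
    legArc arrive   = TwoArcs.inn (busArcs y b′)

    legEdges : Leg → List (E R)
    legEdges l = Arc.edges (legArc l)

    path : List (E R)
    path = concatMap legEdges legs

    leg-circle-NotHub : ∀ l {v} → v ∈ verts R (circ (legCircle l)) → v ≢ legStart l → v ≢ legEnd l → NotHub v
    leg-circle-NotHub leave    on v≢hub _ = bus-circle-NotHub b x on v≢hub
    leg-circle-NotHub tailLink on _     _ = link-circle-NotHub b c x on
    leg-circle-NotHub headLink on _     _ = link-circle-NotHub b′ c′ y on
    leg-circle-NotHub arrive   on _ v≢hub = bus-circle-NotHub b′ y on v≢hub

    leg-internal-NotHub : ∀ l → All NotHub (internal R (legEdges l))
    leg-internal-NotHub l = All.tabulate λ v∈ →
      let on , v≢start , v≢end = Arc.inner (legArc l) v∈ in leg-circle-NotHub l on v≢start v≢end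

    path-walk : Walk R (hub x) path (hub y)
    path-walk = Arc.walk (legArc leave) ++ʷ (Arc.walk (legArc tailLink) ++ʷ
                (Arc.walk (legArc headLink) ++ʷ (Arc.walk (legArc arrive) ++ʷ [])))

    -- The path ends in the ++ [] of concatMap, whose junction hub y is a hub; ++-identityʳ drops it.
    path-avoids-hubs : All NotHub (internal R path)
    path-avoids-hubs =
      internal-++⁺ (Arc.walk (legArc leave)) (leg-internal-NotHub leave)
        (link-circle-NotHub b c x (port∈link x b c))
      (internal-++⁺ (Arc.walk (legArc tailLink)) (leg-internal-NotHub tailLink)
        (link-circle-NotHub b′ c′ y (proj₁ (junction∈circ in≢out)))
      (internal-++⁺ (Arc.walk (legArc headLink)) (leg-internal-NotHub headLink)
        (link-circle-NotHub b′ c′ y (port∈link y b′ c′))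
      (subst (All NotHub ∘ internal R) (sym (++-identityʳ _)) (leg-internal-NotHub arrive))))

  leave-arrive-disjoint : ∀ x b y b′ →
                          Disjoint (Arc.edges (TwoArcs.out (busArcs x b))) (Arc.edges (TwoArcs.inn (busArcs y b′)))
  leave-arrive-disjoint x b y b′ (p , q)
    with circle-injective (bus b) x (bus b′) y
           (circ-unique (Arc.⊆cs (TwoArcs.out (busArcs x b)) p) (Arc.⊆cs (TwoArcs.inn (busArcs y b′)) q))
  ... | refl , refl = TwoArcs.disjoint (busArcs x b) (p , q)

  legs-of-same-circle : ∀ {e e′ f} l l′ → legRole e l ≡ legRole e′ l′ → legVertex e l ≡ legVertex e′ l′ →
                        f ∈ legEdges e l → f ∈ legEdges e′ l′ → e ≡ e′ × l ≡ l′
  legs-of-same-circle leave    leave    r≡ x≡ _ _ = outLabel-injective x≡ (bus-injective r≡) , refl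
  legs-of-same-circle leave    tailLink () _ _ _
  legs-of-same-circle leave    headLink () _ _ _
  legs-of-same-circle {e} {e′} leave arrive _ _ p q =
    ⊥-elim (leave-arrive-disjoint (tail G e) (outLabel e) (head G e′) (inLabel e′) (p , q))
  legs-of-same-circle tailLink leave    () _ _ _
  legs-of-same-circle tailLink tailLink r≡ x≡ _ _ = outLabel-injective x≡ (proj₁ (link-injective r≡)) , refl
  legs-of-same-circle tailLink headLink r≡ x≡ _ _ =
    let b≡ , c≡ = link-injective r≡ in ⊥-elim (first≢not-first x≡ b≡ c≡)
  legs-of-same-circle tailLink arrive   () _ _ _
  legs-of-same-circle headLink leave    () _ _ _
  legs-of-same-circle headLink tailLink r≡ x≡ _ _ =
    let b≡ , c≡ = link-injective r≡ in ⊥-elim (first≢not-first (sym x≡) (sym b≡) (sym c≡))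
  legs-of-same-circle headLink headLink r≡ x≡ _ _ = inLabel-injective x≡ (proj₁ (link-injective r≡)) , refl
  legs-of-same-circle headLink arrive   () _ _ _
  legs-of-same-circle {e} {e′} arrive leave _ _ p q =
    ⊥-elim (leave-arrive-disjoint (tail G e′) (outLabel e′) (head G e) (inLabel e) (q , p))
  legs-of-same-circle arrive   tailLink () _ _ _
  legs-of-same-circle arrive   headLink () _ _ _
  legs-of-same-circle arrive   arrive   r≡ x≡ _ _ = inLabel-injective x≡ (bus-injective r≡) , refl

  leg-injective : ∀ {e e′ l l′ f} → f ∈ legEdges e l → f ∈ legEdges e′ l′ → e ≡ e′ × l ≡ l′
  leg-injective {e} {e′} {l} {l′} p q =
    let r≡ , x≡ = circle-injective (legRole e l) (legVertex e l) (legRole e′ l′) (legVertex e′ l′)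
                    (circ-unique (Arc.⊆cs (legArc e l) p) (Arc.⊆cs (legArc e′ l′) q))
    in legs-of-same-circle l l′ r≡ x≡ p q

  ∈-path⁻ : ∀ {e f} → f ∈ path e → ∃ λ l → f ∈ legEdges e l
  ∈-path⁻ {e} f∈ = satisfied (∈-concatMap⁻ (legEdges e) {legs} f∈)

  legs-disjoint : ∀ e {l l′} → l ≢ l′ → Disjoint (legEdges e l) (legEdges e l′)
  legs-disjoint e {l} {l′} l≢l′ (p , q) = l≢l′ (proj₂ (leg-injective {e} {e} {l} {l′} p q))

  path-unique : ∀ e → Unique (path e)
  path-unique e = Unique.concat⁺
    (All.map⁺ (All.universal (λ l → Arc.unique (legArc e l)) legs))
    (AllPairs.map⁺ (AllPairs.map (legs-disjoint e) legs-unique))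

  path-trail : ∀ e → Trail R (hub (tail G e)) (path e) (hub (head G e))
  path-trail e = path-walk e , path-unique e , λ path≡[] →
    proj₂ (proj₂ (Arc.trail (legArc e leave))) (++-conicalˡ (legEdges e leave) _ path≡[])

  path-disjoint : ∀ {e e′ f} → f ∈ path e → f ∈ path e′ → e ≡ e′
  path-disjoint {e} {e′} f∈e f∈e′ with ∈-path⁻ {e} f∈e | ∈-path⁻ {e′} f∈e′
  ... | l , p | l′ , q = proj₁ (leg-injective {e} {e′} {l} {l′} p q)

  immersion : StrongImmersion G R
  immersion = record
    { φ          = hub
    ; φ-inj      = hub-injective
    ; path       = path
    ; trail      = path-trail
    ; disjoint   = λ e e′ e≢e′ f f∈e f∈e′ → e≢e′ (path-disjoint f∈e f∈e′)
    ; noInternal = λ e v v∈ → All.lookup (path-avoids-hubs e) v∈ v refl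
    }

theorem6p1 : (G : Digraph) → Eulerian G → MaxDegree≤ 4 G →
    (R : Digraph) → Router (6 * nV G) R → StrongImmersion G R
theorem6p1 G eulerian deg≤4 R router = Construction.immersion G eulerian deg≤4 R router
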